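{- Let $(V,(a_{v,w}))$ be a regular normalized weighted CF graph with associated map $\mathbf{T}:C_V\to C_V$, and let $\mu\in C_V$ be a charge. Assume that there is a cusp $\mathfrak{d}$ with vertex set $V(\mathfrak{d})$ such that $V(\mathfrak{d})\cap\mathrm{Supp}(\mu)\neq\varnothing$. Then the set $V(\mathfrak{d})\cap\bigcup_{k=0}^\infty\mathrm{Supp}(\mathbf{T}^k\mu)$ is unbounded (i.e. infinite).
   Context: A weighted CF graph (WCFG) is a countable set $V$ with real weights $a_{v,w}$ ($v,w\in V$) such that each $v$ has finitely many $w$ with $a_{v,w}\ne0$ and finitely many $u$ with $a_{u,v}\neq0$; for $v\neq w$, $a_{v,w}\ne0$ iff $a_{w,v}\ne0$, in which case $v,w$ are neighbours (a nonzero $a_{v,v}$ represents a half edge at $v$); and $V$ is the union of a finite set and the vertex sets of finitely many cusps, a cusp being a sequence of distinct vertices $v_0,v_1,v_2,\dots$ with $v_i,v_{i+1}$ neighbours and, for $i\ge1$, the neighbours of $v_i$ are exactly $v_{i-1},v_{i+1}$ and $a_{v_i,v_i}=0$. It is regular if $a_{v,w}>0$ for all pairs of neighbours, and normalized if $\sum_w a_{v,w}=1$ for every $v$. $C_V$ is the real vector space of finitely supported functions (charges) $\mu:V\to\mathbb{R}$, $\mathrm{Supp}(\mu)=\{v:\mu(v)\neq0\}$, and $\mathbf{T}$ is the linear map $(\mathbf{T}\mu)(y)=\sum_{x\in V}a_{x,y}\mu(x)$. "Unbounded" refers to the natural order $v_0<v_1<\dots$ on the cusp. -}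

module Defs where

open import Data.Nat using (ℕ; zero; suc) renaming (_<_ to _<ℕ_)
open import Data.Product using (Σ; ∃; _×_; _,_)
open import Data.Sum using (_⊎_)
open import Data.List using (List; foldr; map)
open import Data.List.Membership.Propositional using (_∈_)
open import Data.List.Relation.Unary.Unique.Propositional using (Unique)
open import Relation.Nullary using (¬_)
open import Relation.Binary.PropositionalEquality using (_≡_; _≢_)
open import Relation.Binary.Structures using (IsEquivalence)
open import Function.Definitions using (Injective)

-- An (abstract) ordered field; the paper uses the real numbers ℝ.

record OrderedField : Set₁ where
  infixl 6 _+_
  infixl 7 _*_
  infix 4 _≈_ _<_
  field
    Carrier : Set
    _≈_     : Carrier → Carrier → Set
    _+_ _*_ : Carrier → Carrier → Carrier
    -_      : Carrier → Carrier
    0# 1#   : Carrier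
    _<_     : Carrier → Carrier → Set
    ≈-equiv : IsEquivalence _≈_
    +-cong  : ∀ {x y u v} → x ≈ y → u ≈ v → x + u ≈ y + v
    *-cong  : ∀ {x y u v} → x ≈ y → u ≈ v → x * u ≈ y * v
    -‿cong  : ∀ {x y} → x ≈ y → - x ≈ - y
    +-assoc : ∀ x y z → (x + y) + z ≈ x + (y + z)
    +-comm  : ∀ x y → x + y ≈ y + x
    +-identityˡ : ∀ x → 0# + x ≈ x
    -‿inverseˡ : ∀ x → (- x) + x ≈ 0#
    *-assoc : ∀ x y z → (x * y) * z ≈ x * (y * z)
    *-comm  : ∀ x y → x * y ≈ y * x
    *-identityˡ : ∀ x → 1# * x ≈ x
    distribˡ : ∀ x y z → x * (y + z) ≈ (x * y) + (x * z)
    0≉1     : ¬ (0# ≈ 1#)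
    *-inverse : ∀ x → ¬ (x ≈ 0#) → ∃ λ y → x * y ≈ 1#
    <-resp-≈ : ∀ {x y u v} → x ≈ y → u ≈ v → x < u → y < v
    <-irrefl : ∀ x → ¬ (x < x)
    <-trans : ∀ {x y z} → x < y → y < z → x < z
    <-trichotomy : ∀ x y → (x < y) ⊎ (x ≈ y) ⊎ (y < x)
    +-mono-< : ∀ {x y} z → x < y → x + z < y + z
    *-pos   : ∀ {x y} → 0# < x → 0# < y → 0# < x * y

module _ (F : OrderedField) where
  open OrderedField F

  NZ : Carrier → Set
  NZ x = ¬ (x ≈ 0#)

  sumL : {A : Set} → List A → (A → Carrier) → Carrier
  sumL xs f = foldr (λ x acc → f x + acc) 0# xs

  record WCFG : Set₁ where
    field
      V     : Set
      -- countable
      code  : V → ℕ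
      code-inj : Injective _≡_ _≡_ code
      a     : V → V → Carrier
      -- finitely many w with a v w ≠ 0 (duplicate-free list covering them)
      outN  : V → List V
      outN-unique : ∀ v → Unique (outN v)
      outN-covers : ∀ v w → NZ (a v w) → w ∈ outN v
      -- finitely many u with a u v ≠ 0
      inN   : V → List V
      inN-unique : ∀ v → Unique (inN v)
      inN-covers : ∀ u v → NZ (a u v) → u ∈ inN v
      nbr-sym : ∀ v w → v ≢ w → NZ (a v w) → NZ (a w v)

    Nbr : V → V → Set
    Nbr v w = (v ≢ w) × NZ (a v w)

  record IsCusp (G : WCFG) (d : ℕ → WCFG.V G) : Set where
    open WCFG G
    field
      distinct : Injective _≡_ _≡_ d
      consec   : ∀ i → Nbr (d i) (d (suc i))
      onlyNbrs : ∀ i w → Nbr (d (suc i)) w → (w ≡ d i) ⊎ (w ≡ d (suc (suc i)))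
      noHalf   : ∀ i → a (d (suc i)) (d (suc i)) ≈ 0#

  record Cusp (G : WCFG) : Set where
    field
      vtx    : ℕ → WCFG.V G
      isCusp : IsCusp G vtx

  record CFGraph : Set₁ where
    field
      graph  : WCFG
      finite : List (WCFG.V graph)
      cusps  : List (Cusp graph)
      covers : ∀ v → (v ∈ finite) ⊎ (∃ λ c → (c ∈ cusps) × ∃ λ i → Cusp.vtx c i ≡ v)

  module _ (Γ : CFGraph) where
    open CFGraph Γ
    open WCFG graph

    Regular : Set
    Regular = ∀ v w → Nbr v w → 0# < a v w

    Normalized : Set
    Normalized = ∀ v → sumL (outN v) (a v) ≈ 1#

    -- charges: finitely supported functions V → F
    record Charge : Set where
      field
        fun  : V → Carrier
        supp : List V
        supp-covers : ∀ v → NZ (fun v) → v ∈ supp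

    -- (T μ)(y) = Σ_x a_{x,y} μ(x)  (sum over the x with a_{x,y} ≠ 0)
    T : (V → Carrier) → (V → Carrier)
    T f y = sumL (inN y) (λ x → a x y * f x)

    Tpow : ℕ → (V → Carrier) → (V → Carrier)
    Tpow zero f = f
    Tpow (suc k) f = T (Tpow k f)

    InSuppOrbit : Charge → V → Set
    InSuppOrbit μ v = ∃ λ k → NZ (Tpow k (Charge.fun μ) v)

    -- a set S of vertices meets the cusp c in an unbounded set
    -- (for the order v_0 < v_1 < ...): not contained in {v_0,…,v_{n-1}}
    UnboundedOnCusp : Cusp graph → (V → Set) → Set
    UnboundedOnCusp c S = ¬ (∃ λ n → ∀ i → S (Cusp.vtx c i) → i <ℕ n)

{-# OPTIONS --safe #-}
module Submission where

-- On a cusp v₀, v₁, … the only vertices x with a_{x,v_{i+1}} ≠ 0 are v_i and v_{i+2}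
-- (there is no half edge at v_{i+1}), so (T g)(v_{i+1}) = a_{v_i,v_{i+1}} g(v_i)
-- whenever g(v_{i+2}) = 0.  If every Tᵏμ vanished at all v_j with j ≥ n, descending
-- induction on j would give Tᵏμ(v_j) = 0 for all k and j: Tᵏμ(v_{j+2}) = 0 and
-- Tᵏ⁺¹μ(v_{j+1}) = 0 force Tᵏμ(v_j) = 0, because a_{v_j,v_{j+1}} ≠ 0 and a field has
-- no zero divisors.  For k = 0 this contradicts μ(v_i) ≠ 0.

open import Defs
open import Data.Product using (∃; _,_; proj₂)
open import Data.Nat as ℕ using (ℕ; zero; suc)
import Data.Nat.Properties as ℕₚ
open import Data.Sum using (_⊎_; inj₁; inj₂)
open import Data.Empty using (⊥-elim)
open import Data.List using (List; []; _∷_)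
open import Data.List.Membership.Propositional using (_∈_)
open import Data.List.Relation.Unary.Any using (here; there)
open import Data.List.Relation.Unary.All using (lookup)
open import Data.List.Relation.Unary.AllPairs using (_∷_)
open import Data.List.Relation.Unary.Unique.Propositional using (Unique)
open import Function.Bundles using (mk↣)
open import Relation.Nullary using (yes; no)
open import Relation.Binary.Definitions using (DecidableEquality)
open import Relation.Binary.Bundles using (Setoid)
open import Relation.Binary.PropositionalEquality using (_≢_; refl; sym)

module FieldProperties (F : OrderedField) where
  open OrderedField F

  setoid : Setoid _ _
  setoid = record { isEquivalence = ≈-equiv }

  open Setoid setoid public using () renaming (refl to ≈-refl; sym to ≈-sym; trans to ≈-trans)
  open import Relation.Binary.Reasoning.Setoid setoid

  zero-or-nonzero : ∀ x → x ≈ 0# ⊎ NZ F x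
  zero-or-nonzero x with <-trichotomy x 0#
  ... | inj₁ x<0        = inj₂ λ x≈0 → <-irrefl 0# (<-resp-≈ x≈0 ≈-refl x<0)
  ... | inj₂ (inj₁ x≈0) = inj₁ x≈0
  ... | inj₂ (inj₂ 0<x) = inj₂ λ x≈0 → <-irrefl 0# (<-resp-≈ ≈-refl x≈0 0<x)

  +-identityʳ : ∀ x → x + 0# ≈ x
  +-identityʳ x = ≈-trans (+-comm x 0#) (+-identityˡ x)

  *-zeroʳ : ∀ x → x * 0# ≈ 0#
  *-zeroʳ x = begin
    x * 0#                         ≈⟨ ≈-sym (+-identityˡ _) ⟩
    0# + x * 0#                    ≈⟨ +-cong (≈-sym (-‿inverseˡ _)) ≈-refl ⟩
    (- (x * 0#) + x * 0#) + x * 0# ≈⟨ +-assoc _ _ _ ⟩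
    - (x * 0#) + (x * 0# + x * 0#) ≈⟨ +-cong ≈-refl (≈-sym (distribˡ x 0# 0#)) ⟩
    - (x * 0#) + x * (0# + 0#)     ≈⟨ +-cong ≈-refl (*-cong ≈-refl (+-identityˡ 0#)) ⟩
    - (x * 0#) + x * 0#            ≈⟨ -‿inverseˡ _ ⟩
    0#                             ∎

  *-zeroˡ : ∀ x → 0# * x ≈ 0#
  *-zeroˡ x = ≈-trans (*-comm 0# x) (*-zeroʳ x)

  *-nonzero : ∀ {x y} → NZ F x → NZ F y → NZ F (x * y)
  *-nonzero {x} {y} x≉0 y≉0 xy≈0 with *-inverse x x≉0
  ... | x⁻¹ , xx⁻¹≈1 = y≉0 (begin
    y              ≈⟨ ≈-sym (*-identityˡ y) ⟩
    1# * y         ≈⟨ *-cong (≈-trans (≈-sym xx⁻¹≈1) (*-comm x x⁻¹)) ≈-refl ⟩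
    (x⁻¹ * x) * y  ≈⟨ *-assoc x⁻¹ x y ⟩
    x⁻¹ * (x * y)  ≈⟨ *-cong ≈-refl xy≈0 ⟩
    x⁻¹ * 0#       ≈⟨ *-zeroʳ x⁻¹ ⟩
    0#             ∎)

  module _ {A : Set} where

    sumL-zero : ∀ (xs : List A) h → (∀ x → x ∈ xs → h x ≈ 0#) → sumL F xs h ≈ 0#
    sumL-zero [] h _ = ≈-refl
    sumL-zero (x ∷ xs) h h≈0 =
      ≈-trans (+-cong (h≈0 x (here refl)) (sumL-zero xs h (λ y y∈xs → h≈0 y (there y∈xs))))
              (+-identityˡ 0#)

    sumL-single : ∀ (xs : List A) h {p} → Unique xs → p ∈ xs →
                  (∀ x → x ≢ p → h x ≈ 0#) → sumL F xs h ≈ h p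
    sumL-single (x ∷ xs) h (x∉xs ∷ _) (here refl) h≈0 =
      ≈-trans (+-cong ≈-refl (sumL-zero xs h λ y y∈xs → h≈0 y λ y≡x → lookup x∉xs y∈xs (sym y≡x)))
              (+-identityʳ (h x))
    sumL-single (x ∷ xs) h (x∉xs ∷ xs-unique) (there p∈xs) h≈0 =
      ≈-trans (+-cong (h≈0 x (lookup x∉xs p∈xs)) (sumL-single xs h xs-unique p∈xs h≈0))
              (+-identityˡ _)

module OnCusp (F : OrderedField) (Γ : CFGraph F) (c : Cusp F (CFGraph.graph Γ)) where
  open OrderedField F
  open FieldProperties F
  open CFGraph Γ
  open WCFG graph
  open Cusp c renaming (vtx to v)
  open IsCusp isCusp

  _≟_ : DecidableEquality V
  _≟_ = ℕₚ.eq? (mk↣ code-inj)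

  inWeight-zero : ∀ i x → x ≢ v i → x ≢ v (suc (suc i)) → a x (v (suc i)) ≈ 0#
  inWeight-zero i x x≢vᵢ x≢vᵢ₊₂ with x ≟ v (suc i)
  ... | yes refl = noHalf i
  ... | no x≢vᵢ₊₁ with zero-or-nonzero (a x (v (suc i)))
  ...   | inj₁ a≈0 = a≈0
  ...   | inj₂ a≉0 with onlyNbrs i x ((λ e → x≢vᵢ₊₁ (sym e)) , nbr-sym x (v (suc i)) x≢vᵢ₊₁ a≉0)
  ...     | inj₁ x≡vᵢ   = ⊥-elim (x≢vᵢ x≡vᵢ)
  ...     | inj₂ x≡vᵢ₊₂ = ⊥-elim (x≢vᵢ₊₂ x≡vᵢ₊₂)

  T-on-cusp : ∀ g i → g (v (suc (suc i))) ≈ 0# →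
              T F Γ g (v (suc i)) ≈ a (v i) (v (suc i)) * g (v i)
  T-on-cusp g i gvᵢ₊₂≈0 =
    sumL-single (inN (v (suc i))) (λ x → a x (v (suc i)) * g x) (inN-unique _)
                (inN-covers _ _ (proj₂ (consec i))) term-zero
    where
      term-zero : ∀ x → x ≢ v i → a x (v (suc i)) * g x ≈ 0#
      term-zero x x≢vᵢ with x ≟ v (suc (suc i))
      ... | yes refl  = ≈-trans (*-cong ≈-refl gvᵢ₊₂≈0) (*-zeroʳ _)
      ... | no x≢vᵢ₊₂ = ≈-trans (*-cong (inWeight-zero i x x≢vᵢ x≢vᵢ₊₂) ≈-refl) (*-zeroˡ _)

  T-vanishes⇒vanishes : ∀ g i → g (v (suc (suc i))) ≈ 0# → T F Γ g (v (suc i)) ≈ 0# → g (v i) ≈ 0#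
  T-vanishes⇒vanishes g i gvᵢ₊₂≈0 Tgvᵢ₊₁≈0 with zero-or-nonzero (g (v i))
  ... | inj₁ gvᵢ≈0 = gvᵢ≈0
  ... | inj₂ gvᵢ≉0 = ⊥-elim (*-nonzero (proj₂ (consec i)) gvᵢ≉0
                               (≈-trans (≈-sym (T-on-cusp g i gvᵢ₊₂≈0)) Tgvᵢ₊₁≈0))

  OrbitVanishesFrom : (V → Carrier) → ℕ → Set
  OrbitVanishesFrom f n = ∀ k j → n ℕ.≤ j → Tpow F Γ k f (v j) ≈ 0#

  orbitVanishesFrom-pred : ∀ {f m} → OrbitVanishesFrom f (suc m) → OrbitVanishesFrom f m
  orbitVanishesFrom-pred {f} {m} vanishes k j m≤j with ℕₚ.m≤n⇒m<n∨m≡n m≤j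
  ... | inj₁ m<j  = vanishes k j m<j
  ... | inj₂ refl = T-vanishes⇒vanishes (Tpow F Γ k f) m
                      (vanishes k (suc (suc m)) (ℕₚ.n≤1+n (suc m)))
                      (vanishes (suc k) (suc m) ℕₚ.≤-refl)

  orbitVanishesFrom⇒vanishes : ∀ {f} n → OrbitVanishesFrom f n → ∀ k j → Tpow F Γ k f (v j) ≈ 0#
  orbitVanishesFrom⇒vanishes zero    vanishes k j = vanishes k j ℕ.z≤n
  orbitVanishesFrom⇒vanishes (suc n) vanishes     =
    orbitVanishesFrom⇒vanishes n (orbitVanishesFrom-pred vanishes)

  bounded⇒orbitVanishesFrom : ∀ μ n → (∀ i → InSuppOrbit F Γ μ (v i) → i ℕ.< n) →
                              OrbitVanishesFrom (Charge.fun μ) n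
  bounded⇒orbitVanishesFrom μ n bounded k j n≤j with zero-or-nonzero (Tpow F Γ k (Charge.fun μ) (v j))
  ... | inj₁ Tᵏμvⱼ≈0 = Tᵏμvⱼ≈0
  ... | inj₂ Tᵏμvⱼ≉0 = ⊥-elim (ℕₚ.<⇒≱ (bounded j (k , Tᵏμvⱼ≉0)) n≤j)

lemma5p1 : (F : OrderedField) (Γ : CFGraph F) →
    Regular F Γ → Normalized F Γ →
    (μ : Charge F Γ) (d : Cusp F (CFGraph.graph Γ)) →
    (∃ λ i → NZ F (Charge.fun μ (Cusp.vtx d i))) →
    UnboundedOnCusp F Γ d (InSuppOrbit F Γ μ)
lemma5p1 F Γ _ _ μ d (i , μvᵢ≉0) (n , bounded) =
  μvᵢ≉0 (orbitVanishesFrom⇒vanishes n (bounded⇒orbitVanishesFrom μ n bounded) 0 i)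
  where open OnCusp F Γ d
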